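{- There exists an initial connected field of size $z$ and span $s = O(\sqrt{z})$ such that any algorithm (executed by a robot in the model described in the context) that builds a fort starting from this field must use time $\Omega(z^2)$.
   Context: The environment is the infinite oriented square grid $\mathbb{Z}\times\mathbb{Z}$ of cells; each cell has four neighbours (North, East, South, West). A cell containing a brick is full, otherwise empty. The field is the subgraph of the grid induced by the full cells; initially it is connected. Its size is the number $z$ of full cells and its span is the maximum Manhattan distance $|x-x'|+|y-y'|$ between two full cells. A single robot, modelled as a deterministic finite (Mealy) automaton, starts at a full cell; in one time step it moves to one of the four neighbouring cells; it observes only whether its current cell is full, can pick a brick from a full cell and drop a brick into an empty cell, and carries at most one brick at a time. Time is the number of moves of the robot. A fort is the target structure built from all $z$ bricks: a hollow rectangle, i.e. bricks occupy exactly the cells on the perimeter of an axis-parallel rectangle (a perfect fort has all sides with an equal number of bricks); when $z$ is odd, a rough fort is allowed, namely such a rectangle with one additional brick attached at one of its corners. The bound is asymptotic in $z$. -}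

module Defs where

open import Data.Bool using (Bool; true; false; not; _∧_; if_then_else_)
open import Data.Nat as ℕ using (ℕ; zero; suc)
open import Data.Integer as ℤ using (ℤ; ∣_∣)
open import Data.Fin using (Fin)
open import Data.Product using (_×_; _,_; Σ; ∃; ∃-syntax)
open import Data.Product.Properties using (≡-dec)
open import Data.Sum using (_⊎_)
open import Data.List using (List)
open import Data.List.Membership.Propositional using (_∈_)
open import Relation.Nullary using (¬_; does)
open import Relation.Binary.PropositionalEquality using (_≡_)

Cell : Set
Cell = ℤ × ℤ

_≟ᶜ_ : (a b : Cell) → Relation.Nullary.Dec (a ≡ b)
_≟ᶜ_ = ≡-dec ℤ._≟_ ℤ._≟_

manhattan : Cell → Cell → ℕ
manhattan (x , y) (x′ , y′) = ∣ x ℤ.- x′ ∣ ℕ.+ ∣ y ℤ.- y′ ∣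

Adjacent : Cell → Cell → Set
Adjacent a b = manhattan a b ≡ 1

-- Fields (finite sets of full cells, given as lists of distinct cells)

data Walk (F : List Cell) : Cell → Cell → Set where
  stop : ∀ {a} → a ∈ F → Walk F a a
  step : ∀ {a b c} → a ∈ F → Adjacent a b → Walk F b c → Walk F a c

Connected : List Cell → Set
Connected F = ∀ a b → a ∈ F → b ∈ F → Walk F a b

SpanAtMost : List Cell → ℕ → Set
SpanAtMost F s = ∀ a b → a ∈ F → b ∈ F → manhattan a b ℕ.≤ s

isFull : List Cell → Cell → Bool
isFull F c = does (c ∈? F)
  where open import Data.List.Membership.DecPropositional _≟ᶜ_ using (_∈?_)

data Dir : Set where
  north east south west : Dir

move : Dir → Cell → Cell
move north (x , y) = x , y ℤ.+ ℤ.+ 1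
move east  (x , y) = x ℤ.+ ℤ.+ 1 , y
move south (x , y) = x , y ℤ.- ℤ.+ 1
move west  (x , y) = x ℤ.- ℤ.+ 1 , y

data Action : Set where
  idle pick drop : Action

-- n states; input: is the current cell full?; output: brick action and move
record Automaton (n : ℕ) : Set where
  field
    init : Fin n
    δ    : Fin n → Bool → Fin n × Action × Dir

record Config (n : ℕ) : Set where
  field
    state    : Fin n
    pos      : Cell
    carrying : Bool
    full     : Cell → Bool
open Config public

update : (Cell → Bool) → Cell → Bool → Cell → Bool
update f p b c = if does (c ≟ᶜ p) then b else f c

-- perform the brick action at the current cell (impossible actions are no-ops)
act : ∀ {n} → Action → Config n → Config n
act idle cfg = cfg
act pick cfg = if full cfg (pos cfg) ∧ not (carrying cfg)
  then record cfg { carrying = true ; full = update (full cfg) (pos cfg) false }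
  else cfg
act drop cfg = if not (full cfg (pos cfg)) ∧ carrying cfg
  then record cfg { carrying = false ; full = update (full cfg) (pos cfg) true }
  else cfg

stepR : ∀ {n} → Automaton n → Config n → Config n
stepR A cfg with Automaton.δ A (state cfg) (full cfg (pos cfg))
... | q′ , a , d = let c′ = act a cfg in
  record c′ { state = q′ ; pos = move d (pos cfg) }

run : ∀ {n} → Automaton n → Config n → ℕ → Config n
run A cfg zero    = cfg
run A cfg (suc t) = run A (stepR A cfg) t

initial : ∀ {n} → Automaton n → List Cell → Cell → Config n
initial A F p = record
  { state = Automaton.init A ; pos = p ; carrying = false ; full = isFull F }

InRect : ℤ → ℤ → ℤ → ℤ → Cell → Set
InRect x₁ x₂ y₁ y₂ (x , y) = (x₁ ℤ.≤ x × x ℤ.≤ x₂) × (y₁ ℤ.≤ y × y ℤ.≤ y₂)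

OnPerimeter : ℤ → ℤ → ℤ → ℤ → Cell → Set
OnPerimeter x₁ x₂ y₁ y₂ (x , y) =
  InRect x₁ x₂ y₁ y₂ (x , y) × (x ≡ x₁ ⊎ x ≡ x₂ ⊎ y ≡ y₁ ⊎ y ≡ y₂)

HollowRect : (Cell → Bool) → Set
HollowRect full = ∃[ x₁ ] ∃[ x₂ ] ∃[ y₁ ] ∃[ y₂ ]
  (x₁ ℤ.< x₂ × y₁ ℤ.< y₂ ×
   (∀ c → full c ≡ true → OnPerimeter x₁ x₂ y₁ y₂ c) ×
   (∀ c → OnPerimeter x₁ x₂ y₁ y₂ c → full c ≡ true))

IsCorner : ℤ → ℤ → ℤ → ℤ → Cell → Set
IsCorner x₁ x₂ y₁ y₂ (x , y) = (x ≡ x₁ ⊎ x ≡ x₂) × (y ≡ y₁ ⊎ y ≡ y₂)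

RoughFort : (Cell → Bool) → Set
RoughFort full = ∃[ x₁ ] ∃[ x₂ ] ∃[ y₁ ] ∃[ y₂ ] ∃[ k ] ∃[ e ]
  (x₁ ℤ.< x₂ × y₁ ℤ.< y₂ ×
   IsCorner x₁ x₂ y₁ y₂ k × Adjacent k e × ¬ InRect x₁ x₂ y₁ y₂ e ×
   (∀ c → full c ≡ true → OnPerimeter x₁ x₂ y₁ y₂ c ⊎ c ≡ e) ×
   (∀ c → OnPerimeter x₁ x₂ y₁ y₂ c ⊎ c ≡ e → full c ≡ true))

Fort : ℕ → (Cell → Bool) → Set
Fort z full = HollowRect full ⊎ (z ℕ.% 2 ≡ 1 × RoughFort full)

Built : ∀ {n} → ℕ → Config n → Set
Built z cfg = carrying cfg ≡ false × Fort z (full cfg)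

-- The potential of a configuration is the sum of the ℓ¹-norms of the positions of all bricks, a carried
-- brick being counted at the robot's cell. Picking and dropping leave it unchanged and a move raises it by
-- at most one, so after t moves it has grown by at most t. The initial field packs the z bricks row by row
-- into a square of side ⌊√z⌋ + 1 at the origin, of potential O(z^{3/2}), and its span is O(√z). A fort made
-- of z bricks has a side of length B ≥ z / 5, and B consecutive cells of a line have norms summing to at least
-- B²/4 − 1, so the final potential is Ω(z²).
module Submission where

open import Defs
open import Data.Nat using (ℕ; _≤_; _*_)
open import Data.Product using (_×_; ∃-syntax)
open import Data.List using (List; length)
open import Data.List.Membership.Propositional using (_∈_)
open import Data.List.Relation.Unary.Unique.Propositional using (Unique)
open import Relation.Binary.PropositionalEquality using (_≡_)

open import Data.Bool using (Bool; true; false)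
open import Data.Empty using (⊥-elim)
open import Data.Integer as ℤ using (ℤ; +_; ∣_∣; 1ℤ) renaming (suc to sucℤ)
import Data.Integer.Properties as ℤ
open import Data.Integer.Tactic.RingSolver using (solve-∀)
open import Data.List using ([]; _∷_; _++_; [_]; map; upTo)
open import Data.List.Membership.DecPropositional _≟ᶜ_ using (_∈?_)
open import Data.List.Membership.Propositional using (_∉_; _─_)
open import Data.List.Membership.Propositional.Properties
  using (∈-map⁺; ∈-map⁻; ∈-++⁺ˡ; ∈-++⁺ʳ; ∈-upTo⁺; ∈-upTo⁻)
open import Data.List.Properties using (map-∘; map-++; length-map; length-++; length-upTo)
open import Data.List.Relation.Binary.Subset.Propositional using (_⊆_)
open import Data.List.Relation.Unary.All as All using ()
import Data.List.Relation.Unary.All.Properties as All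
open import Data.List.Relation.Unary.AllPairs using ([]; _∷_)
open import Data.List.Relation.Unary.Any using (here; there)
import Data.List.Relation.Unary.Unique.Propositional.Properties as Unique
open import Data.Nat as ℕ using (zero; suc; _+_; _<_; z≤n; s≤s; _%_; _/_)
open import Data.Nat.DivMod using (m≡m%n+[m/n]*n; [m+kn]%n≡m%n; m<n⇒m%n≡m; m%n<n; m<n*o⇒m/o<n)
open import Data.Nat.ListAction using (sum)
open import Data.Nat.ListAction.Properties using (sum-++)
import Data.Nat.Properties as ℕ
open import Data.Nat.Tactic.RingSolver renaming (solve-∀ to ℕsolve-∀)
open import Data.Product using (_,_; proj₁)
open import Data.Product.Properties using (,-injectiveˡ; ,-injectiveʳ)
open import Data.Sum using (_⊎_; inj₁; inj₂; [_,_]′; map₂)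
open import Function using (_∘_; case_of_)
open import Relation.Binary.PropositionalEquality
  using (refl; sym; trans; cong; cong₂; subst; subst₂; _≢_; module ≡-Reasoning)
open import Relation.Nullary using (yes; no)
open import Relation.Nullary.Decidable using (dec-true)
open import Algebra.Properties.CommutativeSemigroup ℕ.+-commutativeSemigroup
  using (x∙yz≈y∙xz; xy∙z≈xz∙y)
import Algebra.Properties.CommutativeSemigroup ℤ.+-commutativeSemigroup as ℤ+
open import Algebra.Properties.AbelianGroup ℤ.+-0-abelianGroup using (xyx⁻¹≈y)

module _ {A : Set} where

  sum-map-─ : ∀ (g : A → ℕ) {x : A} {xs} (p : x ∈ xs) → sum (map g xs) ≡ g x + sum (map g (xs ─ p))
  sum-map-─ g (here refl) = refl
  sum-map-─ g {x} {y ∷ xs} (there p) = begin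
    g y + sum (map g xs)              ≡⟨ cong (_+_ (g y)) (sum-map-─ g p) ⟩
    g y + (g x + sum (map g (xs ─ p))) ≡⟨ x∙yz≈y∙xz (g y) (g x) _ ⟩
    g x + (g y + sum (map g (xs ─ p))) ∎
    where open ≡-Reasoning

  length-─ : ∀ {x : A} {xs} (p : x ∈ xs) → length xs ≡ suc (length (xs ─ p))
  length-─ (here _)  = refl
  length-─ (there p) = cong suc (length-─ p)

  ∈-─⁺ : ∀ {x y : A} {xs} (p : x ∈ xs) → y ≢ x → y ∈ xs → y ∈ (xs ─ p)
  ∈-─⁺ (here refl) y≢x (here refl) = ⊥-elim (y≢x refl)
  ∈-─⁺ (here refl) y≢x (there q)   = q
  ∈-─⁺ (there p)   y≢x (here refl) = here refl
  ∈-─⁺ (there p)   y≢x (there q)   = there (∈-─⁺ p y≢x q)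

  ∈-─⁻ : ∀ {x y : A} {xs} (p : x ∈ xs) → y ∈ (xs ─ p) → y ∈ xs
  ∈-─⁻ (here _)  q         = there q
  ∈-─⁻ (there p) (here eq) = here eq
  ∈-─⁻ (there p) (there q) = there (∈-─⁻ p q)

  ∉-─ : ∀ {x : A} {xs} → Unique xs → (p : x ∈ xs) → x ∉ (xs ─ p)
  ∉-─ (x∉ ∷ _)  (here refl) q         = All.lookup x∉ q refl
  ∉-─ (y∉ ∷ _)  (there p)   (here refl) = All.lookup y∉ p refl
  ∉-─ (_ ∷ u)   (there p)   (there q) = ∉-─ u p q

  Unique-─ : ∀ {x : A} {xs} → Unique xs → (p : x ∈ xs) → Unique (xs ─ p)
  Unique-─ (_ ∷ u)   (here _)  = u
  Unique-─ (y∉ ∷ u)  (there p) = All.─⁺ p y∉ ∷ Unique-─ u p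

  sum-map-⊆ : ∀ (g : A → ℕ) {xs ys : List A} → Unique xs → xs ⊆ ys → sum (map g xs) ≤ sum (map g ys)
  sum-map-⊆ g {[]}     _          _  = z≤n
  sum-map-⊆ g {x ∷ xs} {ys} (x∉ ∷ u) xs⊆ys = begin
    g x + sum (map g xs)       ≤⟨ ℕ.+-monoʳ-≤ (g x) (sum-map-⊆ g u xs⊆ys─p) ⟩
    g x + sum (map g (ys ─ p)) ≡⟨ sum-map-─ g p ⟨
    sum (map g ys)             ∎
    where
    open ℕ.≤-Reasoning
    p : x ∈ ys
    p = xs⊆ys (here refl)
    xs⊆ys─p : xs ⊆ (ys ─ p)
    xs⊆ys─p q = ∈-─⁺ p (λ { refl → All.lookup x∉ q refl }) (xs⊆ys (there q))

  sum-map-const-1 : ∀ (xs : List A) → sum (map (λ _ → 1) xs) ≡ length xs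
  sum-map-const-1 []       = refl
  sum-map-const-1 (_ ∷ xs) = cong suc (sum-map-const-1 xs)

  length-⊆ : ∀ {xs ys : List A} → Unique xs → xs ⊆ ys → length xs ≤ length ys
  length-⊆ {xs} {ys} u xs⊆ys = subst₂ _≤_ (sum-map-const-1 xs) (sum-map-const-1 ys)
    (sum-map-⊆ (λ _ → 1) u xs⊆ys)

  sum-map-≤-length* : ∀ (g : A → ℕ) b (xs : List A) → (∀ {x} → x ∈ xs → g x ≤ b) → sum (map g xs) ≤ length xs * b
  sum-map-≤-length* g b []       _  = z≤n
  sum-map-≤-length* g b (x ∷ xs) g≤ = ℕ.+-mono-≤ (g≤ (here refl)) (sum-map-≤-length* g b xs (g≤ ∘ there))

  sum-map-mono : ∀ {f g : A → ℕ} → (∀ x → f x ≤ g x) → ∀ xs → sum (map f xs) ≤ sum (map g xs)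
  sum-map-mono f≤g []       = z≤n
  sum-map-mono f≤g (x ∷ xs) = ℕ.+-mono-≤ (f≤g x) (sum-map-mono f≤g xs)

sucℤ-+ : ∀ a k → sucℤ a ℤ.+ k ≡ a ℤ.+ sucℤ k
sucℤ-+ a k = trans (ℤ.+-assoc 1ℤ a k) (ℤ+.x∙yz≈y∙xz 1ℤ a k)

n≤∣a∣+∣a+n∣ : ∀ a n → n ≤ ∣ a ∣ + ∣ a ℤ.+ + n ∣
n≤∣a∣+∣a+n∣ a n = begin
  n                           ≡⟨ cong ∣_∣ (xyx⁻¹≈y a (+ n)) ⟨
  ∣ (a ℤ.+ + n) ℤ.- a ∣       ≤⟨ ℤ.∣i-j∣≤∣i∣+∣j∣ (a ℤ.+ + n) a ⟩
  ∣ a ℤ.+ + n ∣ + ∣ a ∣       ≡⟨ ℕ.+-comm _ ∣ a ∣ ⟩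
  ∣ a ∣ + ∣ a ℤ.+ + n ∣       ∎
  where open ℕ.≤-Reasoning

interval : ℤ → ℕ → List ℤ
interval a zero    = [ a ]
interval a (suc n) = a ∷ interval (sucℤ a) n

length-interval : ∀ a n → length (interval a n) ≡ suc n
length-interval a zero    = refl
length-interval a (suc n) = cong suc (length-interval (sucℤ a) n)

∈-interval⁻ : ∀ {a u} n → u ∈ interval a n → a ℤ.≤ u × u ℤ.≤ a ℤ.+ + n
∈-interval⁻ {a} zero    (here refl) = ℤ.≤-refl , ℤ.≤-reflexive (sym (ℤ.+-identityʳ a))
∈-interval⁻ {a} (suc n) (here refl) = ℤ.≤-refl , ℤ.i≤i+j a (+ suc n)
∈-interval⁻ {a} (suc n) (there q) with ∈-interval⁻ n q
... | a<u , u≤ = ℤ.≤-trans (ℤ.i≤suc[i] a) a<u , ℤ.≤-trans u≤ (ℤ.≤-reflexive (sucℤ-+ a (+ n)))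

∈-interval⁺ : ∀ {a u} n → a ℤ.≤ u → u ℤ.≤ a ℤ.+ + n → u ∈ interval a n
∈-interval⁺ {a} zero    a≤u u≤a+0 =
  here (ℤ.≤-antisym (ℤ.≤-trans u≤a+0 (ℤ.≤-reflexive (ℤ.+-identityʳ a))) a≤u)
∈-interval⁺ {a} {u} (suc n) a≤u u≤ with u ℤ.≟ a
... | yes u≡a = here u≡a
... | no  u≢a = there (∈-interval⁺ n (ℤ.i<j⇒suc[i]≤j (ℤ.≤∧≢⇒< a≤u (u≢a ∘ sym)))
                                       (ℤ.≤-trans u≤ (ℤ.≤-reflexive (sym (sucℤ-+ a (+ n))))))

Unique-interval : ∀ a n → Unique (interval a n)
Unique-interval a zero    = All.[] ∷ []
Unique-interval a (suc n) = All.tabulate a≢ ∷ Unique-interval (sucℤ a) n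
  where
  a≢ : ∀ {u} → u ∈ interval (sucℤ a) n → a ≢ u
  a≢ q = ℤ.<⇒≢ (ℤ.suc[i]≤j⇒i<j (proj₁ (∈-interval⁻ n q)))

interval-snoc : ∀ a n → interval a (suc n) ≡ interval a n ++ [ a ℤ.+ + suc n ]
interval-snoc a zero    = cong (λ b → a ∷ [ b ]) (ℤ.+-comm 1ℤ a)
interval-snoc a (suc n) = cong (a ∷_) (trans (interval-snoc (sucℤ a) n)
  (cong (λ b → interval (sucℤ a) n ++ [ b ]) (sucℤ-+ a (+ suc n))))

sum∣interval∣-snoc : ∀ a n →
  sum (map ∣_∣ (interval a (suc n))) ≡ sum (map ∣_∣ (interval a n)) + ∣ a ℤ.+ + suc n ∣
sum∣interval∣-snoc a n = begin
  sum (map ∣_∣ (interval a (suc n)))                              ≡⟨ cong (sum ∘ map ∣_∣) (interval-snoc a n) ⟩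
  sum (map ∣_∣ (interval a n ++ [ b ]))                           ≡⟨ cong sum (map-++ ∣_∣ (interval a n) [ b ]) ⟩
  sum (map ∣_∣ (interval a n) ++ [ ∣ b ∣ ])                       ≡⟨ sum-++ (map ∣_∣ (interval a n)) [ ∣ b ∣ ] ⟩
  sum (map ∣_∣ (interval a n)) + (∣ b ∣ + 0)                      ≡⟨ cong (_+_ (sum (map ∣_∣ (interval a n)))) (ℕ.+-identityʳ ∣ b ∣) ⟩
  sum (map ∣_∣ (interval a n)) + ∣ b ∣                            ∎
  where
  open ≡-Reasoning
  b = a ℤ.+ + suc n

square≤4*sum∣interval∣+4 : ∀ a n → suc n * suc n ≤ 4 * sum (map ∣_∣ (interval a n)) + 4
square≤4*sum∣interval∣+4 a zero          = ℕ.≤-trans (s≤s z≤n) (ℕ.m≤n+m 4 _)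
square≤4*sum∣interval∣+4 a (suc zero)    = ℕ.m≤n+m 4 _
square≤4*sum∣interval∣+4 a (suc (suc m)) = begin
  (3 + m) * (3 + m)                        ≡⟨ square-step m ⟩
  (suc m * suc m) + 4 * (2 + m)            ≤⟨ ℕ.+-mono-≤ (square≤4*sum∣interval∣+4 (sucℤ a) m)
                                                          (ℕ.*-monoʳ-≤ 4 ends) ⟩
  (4 * S + 4) + 4 * (∣ a ∣ + e)            ≡⟨ regroup S ∣ a ∣ e ⟩
  4 * (∣ a ∣ + (S + e)) + 4                ≡⟨ cong (λ s → 4 * (∣ a ∣ + s) + 4) (sum∣interval∣-snoc (sucℤ a) m) ⟨
  4 * sum (map ∣_∣ (interval a (2 + m))) + 4 ∎
  where
  open ℕ.≤-Reasoning
  S = sum (map ∣_∣ (interval (sucℤ a) m))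
  e = ∣ sucℤ a ℤ.+ + suc m ∣
  ends : 2 + m ≤ ∣ a ∣ + e
  ends = subst (λ b → 2 + m ≤ ∣ a ∣ + ∣ b ∣) (sym (sucℤ-+ a (+ suc m))) (n≤∣a∣+∣a+n∣ a (2 + m))
  square-step : ∀ m → (3 + m) * (3 + m) ≡ (suc m * suc m) + 4 * (2 + m)
  square-step = ℕsolve-∀
  regroup : ∀ s x y → (4 * s + 4) + 4 * (x + y) ≡ 4 * (x + (s + y)) + 4
  regroup = ℕsolve-∀

norm : Cell → ℕ
norm (x , y) = ∣ x ∣ + ∣ y ∣

weight : List Cell → ℕ
weight = sum ∘ map norm

row : ℤ → ℤ → ℕ → List Cell
row y a n = map (_, y) (interval a n)

column : ℤ → ℤ → ℕ → List Cell
column x b n = map (x ,_) (interval b n)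

∈-row⁺ : ∀ {a x y} n → a ℤ.≤ x → x ℤ.≤ a ℤ.+ + n → (x , y) ∈ row y a n
∈-row⁺ {y = y} n a≤x x≤ = ∈-map⁺ (_, y) (∈-interval⁺ n a≤x x≤)

∈-column⁺ : ∀ {b x y} n → b ℤ.≤ y → y ℤ.≤ b ℤ.+ + n → (x , y) ∈ column x b n
∈-column⁺ {x = x} n b≤y y≤ = ∈-map⁺ (x ,_) (∈-interval⁺ n b≤y y≤)

∈-row⁻ : ∀ {a y c} n → c ∈ row y a n → ∃[ x ] (c ≡ (x , y) × a ℤ.≤ x × x ℤ.≤ a ℤ.+ + n)
∈-row⁻ {y = y} n p with ∈-map⁻ (_, y) p
... | x , q , refl = x , refl , ∈-interval⁻ n q

∈-column⁻ : ∀ {b x c} n → c ∈ column x b n → ∃[ y ] (c ≡ (x , y) × b ℤ.≤ y × y ℤ.≤ b ℤ.+ + n)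
∈-column⁻ {x = x} n p with ∈-map⁻ (x ,_) p
... | y , q , refl = y , refl , ∈-interval⁻ n q

Unique-row : ∀ y a n → Unique (row y a n)
Unique-row y a n = Unique.map⁺ ,-injectiveˡ (Unique-interval a n)

Unique-column : ∀ x b n → Unique (column x b n)
Unique-column x b n = Unique.map⁺ ,-injectiveʳ (Unique-interval b n)

square≤4*weight-row+4 : ∀ y a n → suc n * suc n ≤ 4 * weight (row y a n) + 4
square≤4*weight-row+4 y a n = begin
  suc n * suc n                                  ≤⟨ square≤4*sum∣interval∣+4 a n ⟩
  4 * sum (map ∣_∣ I) + 4                        ≤⟨ ℕ.+-monoˡ-≤ 4 (ℕ.*-monoʳ-≤ 4
                                                      (sum-map-mono (λ x → ℕ.m≤m+n ∣ x ∣ ∣ y ∣) I)) ⟩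
  4 * sum (map (norm ∘ (_, y)) I) + 4            ≡⟨ cong (λ s → 4 * sum s + 4) (map-∘ I) ⟩
  4 * weight (row y a n) + 4                     ∎
  where
  open ℕ.≤-Reasoning
  I = interval a n

square≤4*weight-column+4 : ∀ x b n → suc n * suc n ≤ 4 * weight (column x b n) + 4
square≤4*weight-column+4 x b n = begin
  suc n * suc n                                  ≤⟨ square≤4*sum∣interval∣+4 b n ⟩
  4 * sum (map ∣_∣ I) + 4                        ≤⟨ ℕ.+-monoˡ-≤ 4 (ℕ.*-monoʳ-≤ 4
                                                      (sum-map-mono (λ y → ℕ.m≤n+m ∣ y ∣ ∣ x ∣) I)) ⟩
  4 * sum (map (norm ∘ (x ,_)) I) + 4            ≡⟨ cong (λ s → 4 * sum s + 4) (map-∘ I) ⟩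
  4 * weight (column x b n) + 4                  ∎
  where
  open ℕ.≤-Reasoning
  I = interval b n

j≡i+[j-i] : ∀ i j → j ≡ i ℤ.+ (j ℤ.- i)
j≡i+[j-i] = solve-∀

≤⇒offset : ∀ {i j} → i ℤ.≤ j → ∃[ n ] j ≡ i ℤ.+ + n
≤⇒offset {i} {j} i≤j = ∣ j ℤ.- i ∣ ,
  trans (j≡i+[j-i] i j) (cong (ℤ._+_ i) (sym (ℤ.0≤i⇒+∣i∣≡i (ℤ.i≤j⇒0≤j-i i≤j))))

perimeter : ℤ → ℤ → ℕ → ℕ → List Cell
perimeter x y w h = row y x w ++ row (y ℤ.+ + h) x w ++ column x y h ++ column (x ℤ.+ + w) y h

length-perimeter : ∀ x y w h → length (perimeter x y w h) ≡ suc w + (suc w + (suc h + suc h))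
length-perimeter x y w h = begin
  length (perimeter x y w h)                                  ≡⟨ length-++ (row y x w) ⟩
  length (row y x w) + length (row (y ℤ.+ + h) x w ++ _)      ≡⟨ cong (_+_ (length (row y x w))) (length-++ (row _ x w)) ⟩
  length (row y x w) + (length (row _ x w) + length (column x y h ++ _))
    ≡⟨ cong (λ k → length (row y x w) + (length (row _ x w) + k)) (length-++ (column x y h)) ⟩
  length (row y x w) + (length (row _ x w) + (length (column x y h) + length (column _ y h)))
    ≡⟨ cong₂ _+_ (len-row y) (cong₂ _+_ (len-row _) (cong₂ _+_ (len-col x) (len-col _))) ⟩
  suc w + (suc w + (suc h + suc h))                           ∎
  where
  open ≡-Reasoning
  len-row : ∀ b → length (row b x w) ≡ suc w
  len-row b = trans (length-map (_, b) (interval x w)) (length-interval x w)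
  len-col : ∀ a → length (column a y h) ≡ suc h
  len-col a = trans (length-map (a ,_) (interval y h)) (length-interval y h)

∈-perimeter : ∀ {x y w h c} → OnPerimeter x (x ℤ.+ + w) y (y ℤ.+ + h) c → c ∈ perimeter x y w h
∈-perimeter {x} {y} {w} {h} (((_ , _) , (y≤ , ≤y)) , inj₁ refl) =
  ∈-++⁺ʳ (row y x w) (∈-++⁺ʳ (row _ x w) (∈-++⁺ˡ (∈-column⁺ h y≤ ≤y)))
∈-perimeter {x} {y} {w} {h} (((_ , _) , (y≤ , ≤y)) , inj₂ (inj₁ refl)) =
  ∈-++⁺ʳ (row y x w) (∈-++⁺ʳ (row _ x w) (∈-++⁺ʳ (column x y h) (∈-column⁺ h y≤ ≤y)))
∈-perimeter {x} {y} {w} {h} (((x≤ , ≤x) , (_ , _)) , inj₂ (inj₂ (inj₁ refl))) =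
  ∈-++⁺ˡ (∈-row⁺ w x≤ ≤x)
∈-perimeter {x} {y} {w} {h} (((x≤ , ≤x) , (_ , _)) , inj₂ (inj₂ (inj₂ refl))) =
  ∈-++⁺ʳ (row y x w) (∈-++⁺ˡ (∈-row⁺ w x≤ ≤x))

row-on-perimeter : ∀ {x₁ y₁ y₂ w c} → y₁ ℤ.≤ y₂ → c ∈ row y₁ x₁ w → OnPerimeter x₁ (x₁ ℤ.+ + w) y₁ y₂ c
row-on-perimeter {w = w} y₁≤y₂ p with ∈-row⁻ w p
... | _ , refl , x₁≤ , ≤x₂ = ((x₁≤ , ≤x₂) , (ℤ.≤-refl , y₁≤y₂)) , inj₂ (inj₂ (inj₁ refl))

column-on-perimeter : ∀ {x₁ x₂ y₁ h c} → x₁ ℤ.≤ x₂ → c ∈ column x₁ y₁ h → OnPerimeter x₁ x₂ y₁ (y₁ ℤ.+ + h) c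
column-on-perimeter {h = h} x₁≤x₂ p with ∈-column⁻ h p
... | _ , refl , y₁≤ , ≤y₂ = ((ℤ.≤-refl , x₁≤x₂) , (y₁≤ , ≤y₂)) , inj₁ refl

square≤-of-longest-side : ∀ {z W H} Φ b → W ≤ suc b → H ≤ suc b → suc b * suc b ≤ 4 * Φ + 4 →
  z ≤ W + (W + (H + H)) + 1 → z * z ≤ 100 * Φ + 100
square≤-of-longest-side {z} {W} {H} Φ b W≤B H≤B B²≤ z≤ = begin
  z * z               ≤⟨ ℕ.*-mono-≤ z≤5B z≤5B ⟩
  5 * B * (5 * B)     ≡⟨ twenty-five b ⟩
  25 * (B * B)        ≤⟨ ℕ.*-monoʳ-≤ 25 B²≤ ⟩
  25 * (4 * Φ + 4)    ≡⟨ hundred Φ ⟩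
  100 * Φ + 100       ∎
  where
  open ℕ.≤-Reasoning
  B = suc b
  five : ∀ b → suc b + (suc b + (suc b + suc b)) + suc b ≡ 5 * suc b
  five = ℕsolve-∀
  z≤5B : z ≤ 5 * B
  z≤5B = begin
    z                         ≤⟨ z≤ ⟩
    W + (W + (H + H)) + 1     ≤⟨ ℕ.+-monoˡ-≤ 1 (ℕ.+-mono-≤ W≤B (ℕ.+-mono-≤ W≤B (ℕ.+-mono-≤ H≤B H≤B))) ⟩
    B + (B + (B + B)) + 1     ≤⟨ ℕ.+-monoʳ-≤ (B + (B + (B + B))) (s≤s z≤n) ⟩
    B + (B + (B + B)) + B     ≡⟨ five b ⟩
    5 * B                     ∎
  twenty-five : ∀ b → 5 * suc b * (5 * suc b) ≡ 25 * (suc b * suc b)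
  twenty-five = ℕsolve-∀
  hundred : ∀ Φ → 25 * (4 * Φ + 4) ≡ 100 * Φ + 100
  hundred = ℕsolve-∀

rectangle-square≤weight : ∀ {x y w h} {L E : List Cell} → Unique L → length E ≤ 1 →
  (∀ c → c ∈ L → OnPerimeter x (x ℤ.+ + w) y (y ℤ.+ + h) c ⊎ c ∈ E) →
  (∀ c → OnPerimeter x (x ℤ.+ + w) y (y ℤ.+ + h) c → c ∈ L) →
  length L * length L ≤ 100 * weight L + 100
rectangle-square≤weight {x} {y} {w} {h} {L} {E} uL |E|≤1 L⊆P∪E P⊆L =
  [ (λ W≤H → square≤-of-longest-side (weight L) h W≤H ℕ.≤-refl tall count)
  , (λ H≤W → square≤-of-longest-side (weight L) w ℕ.≤-refl H≤W wide count)
  ]′ (ℕ.≤-total (suc w) (suc h))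
  where
  L⊆ : L ⊆ perimeter x y w h ++ E
  L⊆ {c} c∈L with L⊆P∪E c c∈L
  ... | inj₁ onP = ∈-++⁺ˡ (∈-perimeter onP)
  ... | inj₂ c∈E = ∈-++⁺ʳ (perimeter x y w h) c∈E
  count : length L ≤ suc w + (suc w + (suc h + suc h)) + 1
  count = begin
    length L                                 ≤⟨ length-⊆ uL L⊆ ⟩
    length (perimeter x y w h ++ E)          ≡⟨ length-++ (perimeter x y w h) ⟩
    length (perimeter x y w h) + length E    ≤⟨ ℕ.+-mono-≤ (ℕ.≤-reflexive (length-perimeter x y w h)) |E|≤1 ⟩
    suc w + (suc w + (suc h + suc h)) + 1    ∎
    where open ℕ.≤-Reasoning
  wide : suc w * suc w ≤ 4 * weight L + 4
  wide = ℕ.≤-trans (square≤4*weight-row+4 y x w)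
    (ℕ.+-monoˡ-≤ 4 (ℕ.*-monoʳ-≤ 4 (sum-map-⊆ norm (Unique-row y x w)
      (P⊆L _ ∘ row-on-perimeter (ℤ.i≤i+j y (+ h))))))
  tall : suc h * suc h ≤ 4 * weight L + 4
  tall = ℕ.≤-trans (square≤4*weight-column+4 x y h)
    (ℕ.+-monoˡ-≤ 4 (ℕ.*-monoʳ-≤ 4 (sum-map-⊆ norm (Unique-column x y h)
      (P⊆L _ ∘ column-on-perimeter (ℤ.i≤i+j x (+ w))))))

perimeter-square≤weight : ∀ {x₁ x₂ y₁ y₂} {L E : List Cell} → x₁ ℤ.≤ x₂ → y₁ ℤ.≤ y₂ →
  Unique L → length E ≤ 1 →
  (∀ c → c ∈ L → OnPerimeter x₁ x₂ y₁ y₂ c ⊎ c ∈ E) →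
  (∀ c → OnPerimeter x₁ x₂ y₁ y₂ c → c ∈ L) →
  length L * length L ≤ 100 * weight L + 100
perimeter-square≤weight x₁≤x₂ y₁≤y₂ with ≤⇒offset x₁≤x₂ | ≤⇒offset y₁≤y₂
... | _ , refl | _ , refl = rectangle-square≤weight

fort-square≤weight : ∀ {z f L} → Unique L → (∀ c → f c ≡ true → c ∈ L) → (∀ c → c ∈ L → f c ≡ true) →
  Fort z f → length L * length L ≤ 100 * weight L + 100
fort-square≤weight uL f⇒∈ ∈⇒f (inj₁ (_ , _ , _ , _ , x₁<x₂ , y₁<y₂ , f⇒P , P⇒f)) =
  perimeter-square≤weight {E = []} (ℤ.<⇒≤ x₁<x₂) (ℤ.<⇒≤ y₁<y₂) uL z≤n
    (λ c c∈L → inj₁ (f⇒P c (∈⇒f c c∈L))) (λ c onP → f⇒∈ c (P⇒f c onP))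
fort-square≤weight uL f⇒∈ ∈⇒f (inj₂ (_ , _ , _ , _ , _ , _ , e , x₁<x₂ , y₁<y₂ , _ , _ , _ , f⇒P∪e , P∪e⇒f)) =
  perimeter-square≤weight {E = [ e ]} (ℤ.<⇒≤ x₁<x₂) (ℤ.<⇒≤ y₁<y₂) uL ℕ.≤-refl
    (λ c c∈L → map₂ (λ { refl → here refl }) (f⇒P∪e c (∈⇒f c c∈L)))
    (λ c onP → f⇒∈ c (P∪e⇒f c (inj₁ onP)))

norm-move : ∀ d p → norm (move d p) ≤ norm p + 1
norm-move north (x , y) = ℕ.≤-trans (ℕ.+-monoʳ-≤ ∣ x ∣ (ℤ.∣i+j∣≤∣i∣+∣j∣ y 1ℤ))
                                    (ℕ.≤-reflexive (sym (ℕ.+-assoc ∣ x ∣ ∣ y ∣ 1)))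
norm-move south (x , y) = ℕ.≤-trans (ℕ.+-monoʳ-≤ ∣ x ∣ (ℤ.∣i-j∣≤∣i∣+∣j∣ y 1ℤ))
                                    (ℕ.≤-reflexive (sym (ℕ.+-assoc ∣ x ∣ ∣ y ∣ 1)))
norm-move east  (x , y) = ℕ.≤-trans (ℕ.+-monoˡ-≤ ∣ y ∣ (ℤ.∣i+j∣≤∣i∣+∣j∣ x 1ℤ))
                                    (ℕ.≤-reflexive (xy∙z≈xz∙y (∣ x ∣) 1 (∣ y ∣)))
norm-move west  (x , y) = ℕ.≤-trans (ℕ.+-monoˡ-≤ ∣ y ∣ (ℤ.∣i-j∣≤∣i∣+∣j∣ x 1ℤ))
                                    (ℕ.≤-reflexive (xy∙z≈xz∙y (∣ x ∣) 1 (∣ y ∣)))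

update-≡ : ∀ f p b → update f p b p ≡ b
update-≡ f p b with p ≟ᶜ p
... | yes _   = refl
... | no  p≢p = ⊥-elim (p≢p refl)

held : Bool → ℕ
held true  = 1
held false = 0

heldWeight : Bool → Cell → ℕ
heldWeight true  p = norm p
heldWeight false _ = 0

heldWeight-move : ∀ b d p → heldWeight b (move d p) ≤ heldWeight b p + 1
heldWeight-move true  d p = norm-move d p
heldWeight-move false d p = z≤n

potential : ∀ {n} → Config n → List Cell → ℕ
potential cfg L = weight L + heldWeight (carrying cfg) (pos cfg)

record Bricks (z : ℕ) (f : Cell → Bool) (carried : Bool) (L : List Cell) : Set where
  field
    distinct : Unique L
    full⇒∈   : ∀ c → f c ≡ true → c ∈ L
    ∈⇒full   : ∀ c → c ∈ L → f c ≡ true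
    total    : length L + held carried ≡ z
open Bricks

module _ {n z : ℕ} where

  act-preserves-potential : ∀ a (cfg : Config n) L → Bricks z (full cfg) (carrying cfg) L →
    ∃[ L′ ] (Bricks z (full (act a cfg)) (carrying (act a cfg)) L′ ×
             weight L′ + heldWeight (carrying (act a cfg)) (pos cfg) ≡ potential cfg L)
  act-preserves-potential idle cfg L B = L , B , refl
  act-preserves-potential pick record { pos = p ; carrying = b ; full = f } L B
    with f p in p-full | b
  ... | false | _     = L , B , refl
  ... | true  | true  = L , B , refl
  ... | true  | false = L ─ p∈L , B′ , picked
    where
    p∈L = full⇒∈ B p p-full
    B′ : Bricks z (update f p false) true (L ─ p∈L)
    B′ .distinct = Unique-─ (distinct B) p∈L
    B′ .full⇒∈ c fc with c ≟ᶜ p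
    ... | yes refl = case fc of λ ()
    ... | no  c≢p  = ∈-─⁺ p∈L c≢p (full⇒∈ B c fc)
    B′ .∈⇒full c c∈ with c ≟ᶜ p
    ... | yes refl = ⊥-elim (∉-─ (distinct B) p∈L c∈)
    ... | no  _    = ∈⇒full B c (∈-─⁻ p∈L c∈)
    B′ .total = trans (ℕ.+-comm _ 1) (trans (sym (length-─ p∈L)) (trans (sym (ℕ.+-identityʳ _)) (total B)))
    picked : weight (L ─ p∈L) + norm p ≡ weight L + 0
    picked = trans (ℕ.+-comm _ (norm p)) (sym (trans (ℕ.+-identityʳ _) (sum-map-─ norm p∈L)))
  act-preserves-potential drop record { pos = p ; carrying = b ; full = f } L B
    with f p in p-full | b
  ... | true  | _     = L , B , refl
  ... | false | false = L , B , refl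
  ... | false | true  = p ∷ L , B′ , dropped
    where
    p∉L : p ∉ L
    p∉L p∈L = case trans (sym (∈⇒full B p p∈L)) p-full of λ ()
    B′ : Bricks z (update f p true) false (p ∷ L)
    B′ .distinct = All.tabulate (λ { c∈L refl → p∉L c∈L }) ∷ distinct B
    B′ .full⇒∈ c fc with c ≟ᶜ p
    ... | yes refl = here refl
    ... | no  _    = there (full⇒∈ B c fc)
    B′ .∈⇒full c (here refl) = update-≡ f p true
    B′ .∈⇒full c (there c∈L) with c ≟ᶜ p
    ... | yes refl = ⊥-elim (p∉L c∈L)
    ... | no  _    = ∈⇒full B c c∈L
    B′ .total = trans (ℕ.+-identityʳ _) (trans (ℕ.+-comm 1 _) (total B))
    dropped : weight (p ∷ L) + 0 ≡ weight L + norm p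
    dropped = trans (ℕ.+-identityʳ _) (ℕ.+-comm (norm p) _)

  step-potential : ∀ (A : Automaton n) cfg L → Bricks z (full cfg) (carrying cfg) L →
    ∃[ L′ ] (Bricks z (full (stepR A cfg)) (carrying (stepR A cfg)) L′ ×
             potential (stepR A cfg) L′ ≤ potential cfg L + 1)
  step-potential A cfg L B with Automaton.δ A (state cfg) (full cfg (pos cfg))
  ... | _ , a , d with act-preserves-potential a cfg L B
  ...   | L′ , B′ , conserved = L′ , B′ , (begin
    weight L′ + heldWeight b (move d (pos cfg))   ≤⟨ ℕ.+-monoʳ-≤ (weight L′) (heldWeight-move b d (pos cfg)) ⟩
    weight L′ + (heldWeight b (pos cfg) + 1)      ≡⟨ ℕ.+-assoc (weight L′) _ 1 ⟨
    weight L′ + heldWeight b (pos cfg) + 1        ≡⟨ cong (_+ 1) conserved ⟩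
    potential cfg L + 1                           ∎)
    where
    open ℕ.≤-Reasoning
    b = carrying (act a cfg)

  run-potential : ∀ (A : Automaton n) t cfg L → Bricks z (full cfg) (carrying cfg) L →
    ∃[ L′ ] (Bricks z (full (run A cfg t)) (carrying (run A cfg t)) L′ ×
             potential (run A cfg t) L′ ≤ potential cfg L + t)
  run-potential A zero    cfg L B = L , B , ℕ.≤-reflexive (sym (ℕ.+-identityʳ _))
  run-potential A (suc t) cfg L B with step-potential A cfg L B
  ... | L₁ , B₁ , step≤ with run-potential A t (stepR A cfg) L₁ B₁
  ...   | L₂ , B₂ , run≤ = L₂ , B₂ , (begin
    potential (run A cfg (suc t)) L₂     ≤⟨ run≤ ⟩
    potential (stepR A cfg) L₁ + t       ≤⟨ ℕ.+-monoˡ-≤ t step≤ ⟩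
    potential cfg L + 1 + t              ≡⟨ ℕ.+-assoc (potential cfg L) 1 t ⟩
    potential cfg L + suc t              ∎)
    where open ℕ.≤-Reasoning

floor-sqrt : ∀ z → ∃[ r ] (r * r ≤ z × z < suc r * suc r)
floor-sqrt zero    = 0 , z≤n , s≤s z≤n
floor-sqrt (suc z) with floor-sqrt z
... | r , r²≤z , z<R² with suc r * suc r ℕ.≤? suc z
...   | yes R²≤ = suc r , R²≤ , ℕ.≤-<-trans z<R² (ℕ.*-mono-< (ℕ.n<1+n (suc r)) (ℕ.n<1+n (suc r)))
...   | no  R²≰ = r , ℕ.m≤n⇒m≤1+n r²≤z , ℕ.≰⇒> R²≰

adjacent-sym : ∀ {a b} → Adjacent a b → Adjacent b a
adjacent-sym {x , y} {x′ , y′} adj = trans (cong₂ _+_ (ℤ.∣i-j∣≡∣j-i∣ x′ x) (ℤ.∣i-j∣≡∣j-i∣ y′ y)) adj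

module _ {F : List Cell} where

  _++ʷ_ : ∀ {a b c} → Walk F a b → Walk F b c → Walk F a c
  stop _         ++ʷ w′ = w′
  step a∈ adj w  ++ʷ w′ = step a∈ adj (w ++ʷ w′)

  walk-start : ∀ {a b} → Walk F a b → a ∈ F
  walk-start (stop a∈)     = a∈
  walk-start (step a∈ _ _) = a∈

  reverseʷ : ∀ {a b} → Walk F a b → Walk F b a
  reverseʷ (stop a∈)               = stop a∈
  reverseʷ (step {a} {b} a∈ adj w) = reverseʷ w ++ʷ step (walk-start w) (adjacent-sym {a} {b} adj) (stop a∈)

1+i-i≡1 : ∀ i → (1ℤ ℤ.+ i) ℤ.- i ≡ 1ℤ
1+i-i≡1 = solve-∀

adjacent-west : ∀ a y → Adjacent (+ suc a , y) (+ a , y)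
adjacent-west a y = cong₂ _+_ (cong ∣_∣ (1+i-i≡1 (+ a))) (cong ∣_∣ (ℤ.+-inverseʳ y))

adjacent-south : ∀ x b → Adjacent (x , + suc b) (x , + b)
adjacent-south x b = cong₂ _+_ (cong ∣_∣ (ℤ.+-inverseʳ x)) (cong ∣_∣ (1+i-i≡1 (+ b)))

module Square (r : ℕ) where

  k : ℕ
  k = suc r

  cell : ℕ → Cell
  cell j = + (j % k) , + (j / k)

  cell-injective : ∀ {i j} → cell i ≡ cell j → i ≡ j
  cell-injective {i} {j} eq = begin
    i                   ≡⟨ m≡m%n+[m/n]*n i k ⟩
    i % k + i / k * k   ≡⟨ cong₂ (λ a b → a + b * k) (ℤ.+-injective (,-injectiveˡ eq)) (ℤ.+-injective (,-injectiveʳ eq)) ⟩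
    j % k + j / k * k   ≡⟨ m≡m%n+[m/n]*n j k ⟨
    j                   ∎
    where open ≡-Reasoning

  cell-+* : ∀ a b → a < k → cell (a + b * k) ≡ (+ a , + b)
  cell-+* a b a<k = cong₂ _,_ (cong +_ mod≡) (cong +_ div≡)
    where
    mod≡ : (a + b * k) % k ≡ a
    mod≡ = trans ([m+kn]%n≡m%n a b k) (m<n⇒m%n≡m a<k)
    div≡ : (a + b * k) / k ≡ b
    div≡ = ℕ.*-cancelʳ-≡ _ b k (ℕ.+-cancelˡ-≡ a _ _
      (trans (cong (_+ ((a + b * k) / k * k)) (sym mod≡)) (sym (m≡m%n+[m/n]*n (a + b * k) k))))

  square : ℕ → List Cell
  square z = map cell (upTo z)

  Unique-square : ∀ z → Unique (square z)
  Unique-square z = Unique.map⁺ cell-injective (Unique.upTo⁺ z)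

  length-square : ∀ z → length (square z) ≡ z
  length-square z = trans (length-map cell (upTo z)) (length-upTo z)

  ∈-square⁺ : ∀ {z} a b → a < k → a + b * k < z → (+ a , + b) ∈ square z
  ∈-square⁺ {z} a b a<k lt = subst (_∈ square z) (cell-+* a b a<k) (∈-map⁺ cell (∈-upTo⁺ lt))

  ∈-square⁻ : ∀ {z c} → c ∈ square z → ∃[ j ] (j < z × c ≡ cell j)
  ∈-square⁻ p with ∈-map⁻ cell p
  ... | j , j∈ , eq = j , ∈-upTo⁻ j∈ , eq

  ∈-square⇒coordinates≤ : ∀ {z c} → z ≤ k * k → c ∈ square z → ∃[ a ] ∃[ b ] (a ≤ r × b ≤ r × c ≡ (+ a , + b))
  ∈-square⇒coordinates≤ z≤k² p with ∈-square⁻ p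
  ... | j , j<z , refl = j % k , j / k , ℕ.<⇒≤pred (m%n<n j k) ,
    ℕ.<⇒≤pred (m<n*o⇒m/o<n {j} {k} {k} (ℕ.<-≤-trans j<z z≤k²)) , refl

  module _ {z : ℕ} where

    walk-along-row : ∀ a b → a < k → a + b * k < z → Walk (square z) (+ a , + b) (+ 0 , + b)
    walk-along-row zero    b _   lt = stop (∈-square⁺ 0 b (s≤s z≤n) lt)
    walk-along-row (suc a) b a<k lt = step (∈-square⁺ (suc a) b a<k lt) (adjacent-west a (+ b))
      (walk-along-row a b (ℕ.<⇒≤ a<k) (ℕ.<⇒≤ lt))

    walk-down-column : ∀ b → b * k < z → Walk (square z) (+ 0 , + b) (+ 0 , + 0)
    walk-down-column zero    lt = stop (∈-square⁺ 0 0 (s≤s z≤n) lt)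
    walk-down-column (suc b) lt = step (∈-square⁺ 0 (suc b) (s≤s z≤n) lt) (adjacent-south (+ 0) b)
      (walk-down-column b (ℕ.≤-<-trans (ℕ.m≤n+m (b * k) k) lt))

    walk-to-origin : ∀ {c} → c ∈ square z → Walk (square z) c (+ 0 , + 0)
    walk-to-origin p with ∈-square⁻ p
    ... | j , j<z , refl =
      walk-along-row (j % k) (j / k) (m%n<n j k) lt ++ʷ walk-down-column (j / k) (ℕ.≤-<-trans (ℕ.m≤n+m _ (j % k)) lt)
      where
      lt : j % k + j / k * k < z
      lt = subst (_< z) (m≡m%n+[m/n]*n j k) j<z

    Connected-square : Connected (square z)
    Connected-square a b a∈ b∈ = walk-to-origin a∈ ++ʷ reverseʷ (walk-to-origin b∈)

    module _ (z≤k² : z ≤ k * k) where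

      span-square : SpanAtMost (square z) ((r + r) + (r + r))
      span-square c c′ p q with ∈-square⇒coordinates≤ z≤k² p | ∈-square⇒coordinates≤ z≤k² q
      ... | a , b , a≤r , b≤r , refl | a′ , b′ , a′≤r , b′≤r , refl =
        ℕ.+-mono-≤ (ℕ.≤-trans (ℤ.∣i-j∣≤∣i∣+∣j∣ (+ a) (+ a′)) (ℕ.+-mono-≤ a≤r a′≤r))
                   (ℕ.≤-trans (ℤ.∣i-j∣≤∣i∣+∣j∣ (+ b) (+ b′)) (ℕ.+-mono-≤ b≤r b′≤r))

      weight-square : weight (square z) ≤ z * (r + r)
      weight-square = subst (λ n → weight (square z) ≤ n * (r + r)) (length-square z)
        (sum-map-≤-length* norm (r + r) (square z) norm≤)
        where
        norm≤ : ∀ {c} → c ∈ square z → norm c ≤ r + r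
        norm≤ p with ∈-square⇒coordinates≤ z≤k² p
        ... | a , b , a≤r , b≤r , refl = ℕ.+-mono-≤ a≤r b≤r

isFull⇒∈ : ∀ F c → isFull F c ≡ true → c ∈ F
isFull⇒∈ F c full with c ∈? F
... | yes c∈F = c∈F
... | no  _   = case full of λ ()

∈⇒isFull : ∀ F c → c ∈ F → isFull F c ≡ true
∈⇒isFull F c c∈F = dec-true (c ∈? F) c∈F

initial-bricks : ∀ {z F} → Unique F → length F ≡ z → Bricks z (isFull F) false F
initial-bricks {F = F} uF |F|≡z = record
  { distinct = uF ; full⇒∈ = isFull⇒∈ F ; ∈⇒full = ∈⇒isFull F ; total = trans (ℕ.+-identityʳ _) |F|≡z }

fort-time-bound : ∀ {n z} (A : Automaton n) F p t → Unique F → length F ≡ z →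
  Built z (run A (initial A F p) t) → z * z ≤ 100 * (weight F + t) + 100
fort-time-bound {z = z} A F p t uF |F|≡z (empty-handed , fort)
  with run-potential {z = z} A t (initial A F p) F (initial-bricks uF |F|≡z)
... | L , B , potential≤ = begin
  z * z                                  ≡⟨ cong (λ m → m * m) |L|≡z ⟨
  length L * length L                    ≤⟨ fort-square≤weight {z = z} (distinct B) (full⇒∈ B) (∈⇒full B) fort ⟩
  100 * weight L + 100                   ≤⟨ ℕ.+-monoˡ-≤ 100 (ℕ.*-monoʳ-≤ 100 weight≤) ⟩
  100 * (weight F + t) + 100             ∎
  where
  open ℕ.≤-Reasoning
  final = run A (initial A F p) t
  |L|≡z : length L ≡ z
  |L|≡z = trans (sym (ℕ.+-identityʳ _)) (subst (λ b → length L + held b ≡ z) empty-handed (total B))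
  weight≤ : weight L ≤ weight F + t
  weight≤ = ℕ.≤-trans (ℕ.m≤m+n (weight L) (heldWeight (carrying final) (pos final)))
    (ℕ.≤-trans potential≤ (ℕ.+-monoˡ-≤ t (ℕ.≤-reflexive (ℕ.+-identityʳ (weight F)))))

quadratic-time : ∀ {z r t} → 401 * 401 ≤ z → r * r ≤ z → z < suc r * suc r →
  z * z ≤ 100 * (z * (r + r) + t) + 100 → z * z ≤ 200 * t
quadratic-time {z} {r} {t} 401²≤z r²≤z z<R² z²≤ = ℕ.+-cancelˡ-≤ (z * z) _ _ (begin
  z * z + z * z                   ≤⟨ ℕ.+-mono-≤ z²≤X+100t z²≤X+100t ⟩
  (X + 100 * t) + (X + 100 * t)   ≡⟨ regroup X t ⟩
  (X + X) + 200 * t               ≤⟨ ℕ.+-monoˡ-≤ (200 * t) X+X≤z² ⟩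
  z * z + 200 * t                 ∎)
  where
  open ℕ.≤-Reasoning
  X = 200 * (r * z) + 100
  expand : ∀ z r t → 100 * (z * (r + r) + t) + 100 ≡ 200 * (r * z) + 100 + 100 * t
  expand = ℕsolve-∀
  regroup : ∀ x t → (x + 100 * t) + (x + 100 * t) ≡ (x + x) + 200 * t
  regroup = ℕsolve-∀
  z²≤X+100t : z * z ≤ X + 100 * t
  z²≤X+100t = ℕ.≤-trans z²≤ (ℕ.≤-reflexive (expand z r t))
  401≤r : 401 ≤ r
  401≤r = ℕ.≮⇒≥ (λ r<401 → ℕ.<⇒≱ z<R² (ℕ.≤-trans (ℕ.*-mono-≤ r<401 r<401) 401²≤z))
  200≤rz : 200 ≤ r * z
  200≤rz = ℕ.≤-trans (ℕ.≤-trans (ℕ.m≤m+n 200 201) 401≤r)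
    (ℕ.≤-trans (ℕ.≤-reflexive (sym (ℕ.*-identityʳ r))) (ℕ.*-monoʳ-≤ r (ℕ.≤-trans (s≤s z≤n) 401²≤z)))
  double-X : ∀ r z → (200 * (r * z) + 100) + (200 * (r * z) + 100) ≡ 400 * (r * z) + 200
  double-X = ℕsolve-∀
  four-hundred-one : ∀ r z → 400 * (r * z) + r * z ≡ 401 * r * z
  four-hundred-one = ℕsolve-∀
  X+X≤z² : X + X ≤ z * z
  X+X≤z² = begin
    X + X                      ≡⟨ double-X r z ⟩
    400 * (r * z) + 200        ≤⟨ ℕ.+-monoʳ-≤ (400 * (r * z)) 200≤rz ⟩
    400 * (r * z) + r * z      ≡⟨ four-hundred-one r z ⟩
    401 * r * z                ≤⟨ ℕ.*-monoˡ-≤ z (ℕ.≤-trans (ℕ.*-monoˡ-≤ r 401≤r) r²≤z) ⟩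
    z * z                      ∎

theorem1 : ∃[ d ] ∃[ K ] ∃[ z₀ ] ∀ z → z₀ ≤ z →
    ∃[ F ] (Unique F × length F ≡ z × Connected F ×
      (∃[ s ] (SpanAtMost F s × s * s ≤ K * z)) ×
      (∀ n (A : Automaton n) (p : Cell) → p ∈ F → ∀ t →
        Built z (run A (initial A F p) t) → z * z ≤ d * t))
theorem1 = 200 , 16 , 401 * 401 , λ z 401²≤z →
  let r , r²≤z , z<R² = floor-sqrt z
      open Square r
      z≤k² = ℕ.<⇒≤ z<R²
  in  square z , Unique-square z , length-square z , Connected-square ,
      ((r + r) + (r + r) , span-square z≤k² , ℕ.≤-trans (ℕ.≤-reflexive (sixteen r)) (ℕ.*-monoʳ-≤ 16 r²≤z)) ,
      λ n A p _ t built → quadratic-time {r = r} 401²≤z r²≤z z<R²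
        (ℕ.≤-trans (fort-time-bound A (square z) p t (Unique-square z) (length-square z) built)
                   (ℕ.+-monoˡ-≤ 100 (ℕ.*-monoʳ-≤ 100 (ℕ.+-monoˡ-≤ t (weight-square z≤k²)))))
  where
  sixteen : ∀ r → (r + r + (r + r)) * (r + r + (r + r)) ≡ 16 * (r * r)
  sixteen = ℕsolve-∀
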